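{- Let $G$ be a complete multipartite graph with distinct maximal partite sets $I_1, I_2, \dots, I_r$ satisfying $|I_1| > |I_2| \geq \dots \geq |I_r|$. Let $k \geq 3$ be an integer and $m \geq k\,\alpha_k(G)$ an integer. Let $w$ and $w'$ be $m$-weightings of $G$ such that $w$ is uniform-$\alpha$ and $w'$ is uniform on a largest $k$-clique independent set of $G$. Then $\pi_k(G(w)) < \pi_k(G(w'))$.
   Context: All graphs are simple. $\mathbb{N}_0 = \{0,1,2,\dots\}$. For a graph $G$, a function $w: V(G) \to \mathbb{N}_0$ with $\sum_{v \in V(G)} w(v) = m$ is an $m$-weighting of $G$. $G(w)$ is the graph obtained from $G$ by replacing each vertex $v$ by a clique $K^v$ on $w(v)$ vertices and joining every vertex of $K^u$ to every vertex of $K^v$ whenever $uv \in E(G)$. $\pi_k(H)$ denotes the number of $k$-cliques of a graph $H$. A subset $I \subseteq V(G)$ is a $k$-clique independent set if no $k$ vertices of $I$ induce a $k$-clique of $G$; $\alpha_k(G)$ is the maximum size of a $k$-clique independent set. An $m$-weighting $w$ is uniform on $U \subseteq V(G)$ if $w(v)=0$ for all $v \notin U$ and $w(u) \in \{\lfloor m/|U|\rfloor, \lceil m/|U| \rceil\}$ for all $u \in U$; $w$ is uniform-$\alpha$ if it is uniform on some independent set of $G$ of maximum size. A complete multipartite graph is a graph whose vertex set is the union of pairwise disjoint non-empty sets $I_1,\dots,I_r$ (its maximal partite sets), with $xy$ an edge iff $x$ and $y$ lie in different sets. -}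

module Defs where

open import Data.Nat using (ℕ; zero; suc; _+_; _*_; _∸_; _/_; _≤_; _<_; NonZero)
open import Data.Nat.Properties using (_≟_)
open import Data.Fin as F using (Fin; zero; suc; splitAt)
open import Data.Fin.Properties using (all?) renaming (_≟_ to _≟F_)
open import Data.Fin.Subset using (Subset; _∈_; _∉_; _⊆_; ∣_∣; inside; outside)
open import Data.Fin.Subset.Properties using (_∈?_)
open import Data.Vec using (Vec; []; _∷_; tabulate)
open import Data.List using (List; []; _∷_; _++_; map; filter; length)
open import Data.Product using (Σ; Σ-syntax; _×_; _,_; ∃)
open import Data.Sum using (_⊎_; inj₁; inj₂)
open import Relation.Nullary using (¬_; Dec; does; yes; no)
open import Relation.Nullary.Decidable using (_×-dec_; _→-dec_; ¬?)
open import Relation.Binary.PropositionalEquality using (_≡_; _≢_)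

record Graph (n : ℕ) : Set₁ where
  field
    Adj    : Fin n → Fin n → Set
    adj?   : (x y : Fin n) → Dec (Adj x y)
    sym    : ∀ {x y} → Adj x y → Adj y x
    irrefl : ∀ {x} → ¬ Adj x x
open Graph public

IsClique : ∀ {n} → Graph n → Subset n → Set
IsClique G S = ∀ x y → x ∈ S → y ∈ S → x ≢ y → Adj G x y

isClique? : ∀ {n} (G : Graph n) (S : Subset n) → Dec (IsClique G S)
isClique? G S = all? λ x → all? λ y →
  (x ∈? S) →-dec ((y ∈? S) →-dec ((¬? (x ≟F y)) →-dec adj? G x y))

IsKClique : ∀ {n} → Graph n → ℕ → Subset n → Set
IsKClique G k S = (∣ S ∣ ≡ k) × IsClique G S

isKClique? : ∀ {n} (G : Graph n) (k : ℕ) (S : Subset n) → Dec (IsKClique G k S)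
isKClique? G k S = (∣ S ∣ ≟ k) ×-dec isClique? G S

allSubsets : (n : ℕ) → List (Subset n)
allSubsets zero    = [] ∷ []
allSubsets (suc n) = map (inside ∷_) (allSubsets n) ++ map (outside ∷_) (allSubsets n)

π : ∀ {n} → ℕ → Graph n → ℕ
π k G = length (filter (isKClique? G k) (allSubsets _))

IsIndependent : ∀ {n} → Graph n → Subset n → Set
IsIndependent G S = ∀ x y → x ∈ S → y ∈ S → ¬ Adj G x y

IsMaxIndependent : ∀ {n} → Graph n → Subset n → Set
IsMaxIndependent G S = IsIndependent G S × (∀ T → IsIndependent G T → ∣ T ∣ ≤ ∣ S ∣)

IsKCliqueIndependent : ∀ {n} → Graph n → ℕ → Subset n → Set
IsKCliqueIndependent G k I = ∀ T → T ⊆ I → ¬ IsKClique G k T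

-- k-clique independent set of maximum size (its size is α_k(G))
IsMaxKCliqueIndependent : ∀ {n} → Graph n → ℕ → Subset n → Set
IsMaxKCliqueIndependent G k I =
  IsKCliqueIndependent G k I × (∀ T → IsKCliqueIndependent G k T → ∣ T ∣ ≤ ∣ I ∣)

wsum : ∀ {n} → (Fin n → ℕ) → ℕ
wsum {zero}  w = 0
wsum {suc n} w = w zero + wsum (λ v → w (suc v))

-- the vertex of G whose clique K^v contains a given vertex of G(w);
-- the vertices of G(w) are Fin (wsum w), the first w 0 of them form K^0, etc.
owner : ∀ {n} (w : Fin n → ℕ) → Fin (wsum w) → Fin n
owner {zero}  w ()
owner {suc n} w i with splitAt (w zero) i
... | inj₁ _ = zero
... | inj₂ j = suc (owner (λ v → w (suc v)) j)

BlowAdj : ∀ {n} (G : Graph n) (w : Fin n → ℕ) → Fin (wsum w) → Fin (wsum w) → Set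
BlowAdj G w x y = x ≢ y × ((owner w x ≡ owner w y) ⊎ Adj G (owner w x) (owner w y))

blowup : ∀ {n} → Graph n → (w : Fin n → ℕ) → Graph (wsum w)
blowup {n} G w = record
  { Adj = BlowAdj G w
  ; adj? = dec
  ; sym = λ { (x≢y , inj₁ e) → (λ e' → x≢y (symm e')) , inj₁ (symm e)
            ; (x≢y , inj₂ a) → (λ e' → x≢y (symm e')) , inj₂ (Graph.sym G a) }
  ; irrefl = λ { (x≢x , _) → x≢x refl' }
  }
  where
  open import Relation.Binary.PropositionalEquality using () renaming (sym to symm; refl to refl')
  open import Relation.Nullary.Decidable using () renaming (_⊎-dec_ to _⊎?_)
  dec : ∀ x y → Dec (BlowAdj G w x y)
  dec x y = ¬? (x ≟F y) ×-dec ((owner w x ≟F owner w y) ⊎? adj? G (owner w x) (owner w y))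

ceilDiv : (m s : ℕ) → .{{NonZero s}} → ℕ
ceilDiv m s = (m + (s ∸ 1)) / s

-- w is uniform on U (U must be nonempty so that m/|U| makes sense)
IsUniformOn : ∀ {n} → ℕ → Subset n → (Fin n → ℕ) → Set
IsUniformOn m U w =
  Σ[ nz ∈ NonZero ∣ U ∣ ]
    ((∀ v → v ∉ U → w v ≡ 0) ×
     (∀ u → u ∈ U → (w u ≡ _/_ m ∣ U ∣ {{nz}}) ⊎ (w u ≡ ceilDiv m ∣ U ∣ {{nz}})))

partSet : ∀ {n r} → (Fin n → Fin r) → Fin r → Subset n
partSet part i = tabulate λ v → does (part v ≟F i)

-- G is complete multipartite with maximal partite sets the (nonempty) fibres of `part`
IsCompleteMultipartiteBy : ∀ {n r} → Graph n → (Fin n → Fin r) → Set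
IsCompleteMultipartiteBy G part =
  (∀ i → ∃ λ v → part v ≡ i) ×
  (∀ x y → (Adj G x y → part x ≢ part y) × (part x ≢ part y → Adj G x y))

-- Write a = ∣ I ∣ = α(G). As I is independent, G(w) is the disjoint union of the cliques K^v, so
-- π_k(G(w)) = Σ_v C(w v, k), where w takes only the values ⌊m/a⌋ and ⌈m/a⌉ on a vertices. By convexity
-- of x ↦ C(x, k) (tangent line at ⌊m/a⌋) this is the least value of Σ_j C(s_j, k) over all a-tuples with
-- Σ_j s_j = m.
--
-- A maximum k-clique independent set I′ meets two parts, since for k ≥ 3 the union of any two parts is
-- k-clique independent; pick u, v ∈ I′ in different parts with u outside the largest part I₁. Every
-- part has at most a vertices and the part of u fewer, so V(G) can be coloured with a colours,
-- injectively on every part, with u and v of different colours. Joining the vertices of G(w′) whose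
-- owners share a colour gives a disjoint union of a cliques inside G(w′), with Σ_j C(s_j, k) k-cliques
-- where Σ_j s_j = m; and G(w′) has one more k-clique, meeting both K^u and K^v, which is not
-- monochromatic.

module Submission where

open import Defs hiding (sym)
open import Function using (_∘_; id; case_of_)
open import Level using (0ℓ)
open import Data.Bool using (true; false)
open import Data.Empty using (⊥-elim)
open import Data.Nat using (ℕ; zero; suc; _+_; _*_; _∸_; _/_; _≤_; _<_; z≤n; s≤s; z<s; NonZero)
open import Data.Nat.Properties
open import Data.Nat.Combinatorics using (_C_; nCk+nC[k+1]≡[n+1]C[k+1])
open import Data.Nat.DivMod using (/-monoˡ-≤; m/n≡1+[m∸n]/n; m*n/n≡m)
open import Data.Nat.Tactic.RingSolver using (solve-∀)
open import Data.Fin as Fin using (Fin; zero; suc; toℕ; _↑ˡ_; _↑ʳ_)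
import Data.Fin.Properties as Finₚ
open import Data.Fin.Subset using (Subset; _∈_; _∉_; _⊆_; _⊂_; ∣_∣; inside; outside; _∪_; ⁅_⁆; ⊥; Nonempty)
open import Data.Fin.Subset.Properties
  using (_∈?_; _⊆?_; nonempty?; drop-there; drop-∷-⊆; out⊆; in⊆in; ⊆-min; ⊆-refl; x∈p∪q⁻; p⊆p∪q; q⊆p∪q;
         x∈⁅x⁆; x∈⁅y⁆⇒x≡y; ∣⁅x⁆∣≡1; ∣⊥∣≡0; ∣p∣≤∣p∪q∣; p⊆q⇒∣p∣≤∣q∣; p⊂q⇒∣p∣<∣q∣; x∈p⇒∣p-x∣<∣p∣)
open import Data.Vec using ([]; _∷_; here; there)
import Data.Vec.Properties as Vecₚ
open import Data.List using (List; []; _∷_; _++_; filter; length)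
import Data.List as List
open import Data.List.Properties using (length-++; filter-++; filter-≐; filter-none)
import Data.List.Relation.Unary.All as All
import Data.List.Relation.Unary.Any as Any
open import Data.List.Membership.Propositional using () renaming (_∈_ to _∈ₗ_)
open import Data.List.Relation.Unary.Any using (here; there)
import Data.List.Relation.Unary.Any.Properties as Anyₚ
open import Data.Product using (Σ-syntax; _×_; _,_; ∃; proj₁; proj₂; map; map₂)
open import Data.Sum using (_⊎_; inj₁; inj₂; [_,_]′)
import Data.Sum as Sum
open import Relation.Nullary using (¬_; Dec; does; yes; no; contradiction)
open import Relation.Nullary.Decidable using (_×-dec_; ¬?; dec-true)
open import Relation.Unary using (Pred; Decidable; _≐_)
open import Relation.Binary.PropositionalEquality
open import Relation.Binary.Definitions using (tri<; tri≈; tri>)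

𝟙 : ∀ {p} {P : Set p} → Dec P → ℕ
𝟙 (yes _) = 1
𝟙 (no _)  = 0

𝟙-yes : ∀ {P : Set} → P → (d : Dec P) → 𝟙 d ≡ 1
𝟙-yes p (yes _) = refl
𝟙-yes p (no ¬p) = ⊥-elim (¬p p)

𝟙-no : ∀ {P : Set} → ¬ P → (d : Dec P) → 𝟙 d ≡ 0
𝟙-no ¬p (yes p) = ⊥-elim (¬p p)
𝟙-no ¬p (no _)  = refl

𝟙-no<𝟙-yes : ∀ {P Q : Set} → ¬ P → Q → (d : Dec P) (e : Dec Q) → 𝟙 d < 𝟙 e
𝟙-no<𝟙-yes ¬p q d e = subst₂ _<_ (sym (𝟙-no ¬p d)) (sym (𝟙-yes q e)) z<s

𝟙-mono : ∀ {P Q : Set} → (P → Q) → (d : Dec P) (e : Dec Q) → 𝟙 d ≤ 𝟙 e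
𝟙-mono P⇒Q (yes p) e = ≤-reflexive (sym (𝟙-yes (P⇒Q p) e))
𝟙-mono P⇒Q (no _)  e = z≤n

𝟙-cong : ∀ {P Q : Set} → (P → Q) → (Q → P) → (d : Dec P) (e : Dec Q) → 𝟙 d ≡ 𝟙 e
𝟙-cong P⇒Q Q⇒P d e = ≤-antisym (𝟙-mono P⇒Q d e) (𝟙-mono Q⇒P e d)

𝟙-⊎ : ∀ {P Q R : Set} → (P → Q ⊎ R) → (d : Dec P) (e : Dec Q) (f : Dec R) → 𝟙 d ≤ 𝟙 e + 𝟙 f
𝟙-⊎ h (no _)  e f = z≤n
𝟙-⊎ h (yes p) e f with h p
... | inj₁ q = ≤-trans (≤-reflexive (sym (𝟙-yes q e))) (m≤m+n _ _)
... | inj₂ r = ≤-trans (≤-reflexive (sym (𝟙-yes r f))) (m≤n+m _ _)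

wsum-cong : ∀ {n} (f g : Fin n → ℕ) → (∀ x → f x ≡ g x) → wsum f ≡ wsum g
wsum-cong {zero}  f g f≗g = refl
wsum-cong {suc n} f g f≗g = cong₂ _+_ (f≗g zero) (wsum-cong (f ∘ suc) (g ∘ suc) (f≗g ∘ suc))

wsum-mono-≤ : ∀ {n} (f g : Fin n → ℕ) → (∀ x → f x ≤ g x) → wsum f ≤ wsum g
wsum-mono-≤ {zero}  f g f≤g = z≤n
wsum-mono-≤ {suc n} f g f≤g = +-mono-≤ (f≤g zero) (wsum-mono-≤ (f ∘ suc) (g ∘ suc) (f≤g ∘ suc))

wsum-mono-< : ∀ {n} (f g : Fin n → ℕ) → (∀ x → f x ≤ g x) → ∀ i → f i < g i → wsum f < wsum g
wsum-mono-< f g f≤g zero    fi<gi = +-mono-<-≤ fi<gi (wsum-mono-≤ (f ∘ suc) (g ∘ suc) (f≤g ∘ suc))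
wsum-mono-< f g f≤g (suc i) fi<gi =
  +-mono-≤-< (f≤g zero) (wsum-mono-< (f ∘ suc) (g ∘ suc) (f≤g ∘ suc) i fi<gi)

wsum-const : ∀ n c → wsum {n} (λ _ → c) ≡ n * c
wsum-const zero    c = refl
wsum-const (suc n) c = cong (c +_) (wsum-const n c)

wsum-zero : ∀ n → wsum {n} (λ _ → 0) ≡ 0
wsum-zero n = trans (wsum-const n 0) (*-zeroʳ n)

wsum-distrib-+ : ∀ {n} (f g : Fin n → ℕ) → wsum (λ x → f x + g x) ≡ wsum f + wsum g
wsum-distrib-+ {zero}  f g = refl
wsum-distrib-+ {suc n} f g =
  trans (cong (f zero + g zero +_) (wsum-distrib-+ (f ∘ suc) (g ∘ suc))) (swap (f zero) (g zero) _ _)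
  where
  swap : ∀ a b c d → (a + b) + (c + d) ≡ (a + c) + (b + d)
  swap = solve-∀

wsum-distribʳ-* : ∀ {n} (f : Fin n → ℕ) c → wsum (λ x → f x * c) ≡ wsum f * c
wsum-distribʳ-* {zero}  f c = refl
wsum-distribʳ-* {suc n} f c =
  trans (cong (f zero * c +_) (wsum-distribʳ-* (f ∘ suc) c)) (sym (*-distribʳ-+ c (f zero) _))

wsum-↑ : ∀ a b (f : Fin (a + b) → ℕ) → wsum f ≡ wsum (λ i → f (i ↑ˡ b)) + wsum (λ j → f (a ↑ʳ j))
wsum-↑ zero    b f = refl
wsum-↑ (suc a) b f = trans (cong (f zero +_) (wsum-↑ a b (f ∘ suc))) (sym (+-assoc (f zero) _ _))

wsum-δ : ∀ {n} (i : Fin n) (f : Fin n → ℕ) → wsum (λ j → 𝟙 (i Fin.≟ j) * f j) ≡ f i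
wsum-δ {suc n} zero f = trans (cong₂ _+_ (*-identityˡ (f zero)) (wsum-zero n)) (+-identityʳ (f zero))
wsum-δ {suc n} (suc i) f =
  trans (wsum-cong {n} _ (λ j → 𝟙 (i Fin.≟ j) * f (suc j))
                   (λ j → cong (_* f (suc j))
                                (𝟙-cong Finₚ.suc-injective (cong suc) (suc i Fin.≟ suc j) (i Fin.≟ j))))
        (wsum-δ i (f ∘ suc))

wsum-𝟙≤1 : ∀ {n} {P : Fin n → Set} (P? : ∀ x → Dec (P x)) → (∀ x y → P x → P y → x ≡ y) →
           wsum (λ x → 𝟙 (P? x)) ≤ 1
wsum-𝟙≤1 {zero}  P? unique = z≤n
wsum-𝟙≤1 {suc n} P? unique with P? zero
... | no _   = wsum-𝟙≤1 (P? ∘ suc) (λ x y px py → Finₚ.suc-injective (unique (suc x) (suc y) px py))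
... | yes p0 = s≤s (≤-reflexive (trans (wsum-cong _ (λ _ → 0) none) (wsum-zero n)))
  where
  none : ∀ x → 𝟙 (P? (suc x)) ≡ 0
  none x = 𝟙-no (λ px → Finₚ.0≢1+n (unique zero (suc x) p0 px)) (P? (suc x))

wsum-𝟙>0⇒∃ : ∀ {n} {P : Fin n → Set} (P? : ∀ x → Dec (P x)) → 0 < wsum (λ x → 𝟙 (P? x)) → ∃ P
wsum-𝟙>0⇒∃ {suc n} P? pos with P? zero
... | yes p0 = zero , p0
... | no _   = let x , px = wsum-𝟙>0⇒∃ (P? ∘ suc) pos in suc x , px

∣p∣≡wsum-𝟙 : ∀ {n} (p : Subset n) → ∣ p ∣ ≡ wsum (λ x → 𝟙 (x ∈? p))
∣p∣≡wsum-𝟙 []           = refl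
∣p∣≡wsum-𝟙 (inside ∷ p)  = cong suc (trans (∣p∣≡wsum-𝟙 p) (wsum-cong _ _ (λ x → 𝟙-cong there drop-there (x ∈? p) _)))
∣p∣≡wsum-𝟙 (outside ∷ p) = trans (∣p∣≡wsum-𝟙 p) (wsum-cong _ _ (λ x → 𝟙-cong there drop-there (x ∈? p) _))

0<∣p∣⇒Nonempty : ∀ {n} (p : Subset n) → 0 < ∣ p ∣ → Nonempty p
0<∣p∣⇒Nonempty p 0<∣p∣ = wsum-𝟙>0⇒∃ (_∈? p) (subst (0 <_) (∣p∣≡wsum-𝟙 p) 0<∣p∣)

∃-⊆-of-size : ∀ {N} (A : Subset N) j → j ≤ ∣ A ∣ → Σ[ B ∈ Subset N ] (B ⊆ A × ∣ B ∣ ≡ j)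
∃-⊆-of-size {N} A zero _ = ⊥ , ⊆-min A , ∣⊥∣≡0 N
∃-⊆-of-size (outside ∷ A) (suc j) j≤∣A∣ =
  let B , B⊆A , ∣B∣≡j = ∃-⊆-of-size A (suc j) j≤∣A∣ in outside ∷ B , out⊆ B⊆A , ∣B∣≡j
∃-⊆-of-size (inside ∷ A) (suc j) (s≤s j≤∣A∣) =
  let B , B⊆A , ∣B∣≡j = ∃-⊆-of-size A j j≤∣A∣ in inside ∷ B , in⊆in B⊆A , cong suc ∣B∣≡j

∃-⊆-∋-of-size : ∀ {N} (A : Subset N) {y} → y ∈ A → ∀ j → 0 < j → j ≤ ∣ A ∣ →
                Σ[ B ∈ Subset N ] (B ⊆ A × y ∈ B × ∣ B ∣ ≡ j)
∃-⊆-∋-of-size (inside ∷ A) here (suc j) _ (s≤s j≤∣A∣) =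
  let B , B⊆A , ∣B∣≡j = ∃-⊆-of-size A j j≤∣A∣ in inside ∷ B , in⊆in B⊆A , here , cong suc ∣B∣≡j
∃-⊆-∋-of-size (b ∷ A) (there y∈A) j 0<j j≤∣bA∣ with j ≤? ∣ A ∣
... | yes j≤∣A∣ =
  let B , B⊆A , y∈B , ∣B∣≡j = ∃-⊆-∋-of-size A y∈A j 0<j j≤∣A∣ in outside ∷ B , out⊆ B⊆A , there y∈B , ∣B∣≡j
∃-⊆-∋-of-size (outside ∷ A) (there y∈A) j 0<j j≤∣A∣ | no j≰∣A∣ = ⊥-elim (j≰∣A∣ j≤∣A∣)
∃-⊆-∋-of-size (inside ∷ A)  (there y∈A) j 0<j j≤∣iA∣ | no j≰∣A∣ =
  inside ∷ A , ⊆-refl , there y∈A , ≤-antisym (≰⇒> j≰∣A∣) j≤∣iA∣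

∃-∈-≢ : ∀ {N} (B : Subset N) y → 2 ≤ ∣ B ∣ → Σ[ z ∈ Fin N ] (z ∈ B × z ≢ y)
∃-∈-≢ B y 2≤∣B∣ with Finₚ.any? (λ z → (z ∈? B) ×-dec ¬? (z Fin.≟ y))
... | yes (z , z∈B , z≢y) = z , z∈B , z≢y
... | no ∄z = ⊥-elim (<⇒≱ 2≤∣B∣ (≤-trans (p⊆q⇒∣p∣≤∣q∣ B⊆⁅y⁆) (≤-reflexive (∣⁅x⁆∣≡1 y))))
  where
  B⊆⁅y⁆ : B ⊆ ⁅ y ⁆
  B⊆⁅y⁆ {z} z∈B with z Fin.≟ y
  ... | yes refl = x∈⁅x⁆ z
  ... | no z≢y   = ⊥-elim (∄z (z , z∈B , z≢y))

module _ {n r} (f : Fin n → Fin r) {j : Fin r} {x : Fin n} where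

  ∈-partSet⁺ : f x ≡ j → x ∈ partSet f j
  ∈-partSet⁺ fx≡j = Vecₚ.lookup⇒[]= x _ (trans (Vecₚ.lookup∘tabulate _ x) (dec-true (f x Fin.≟ j) fx≡j))

  ∈-partSet⁻ : x ∈ partSet f j → f x ≡ j
  ∈-partSet⁻ x∈ with f x Fin.≟ j | trans (sym (Vecₚ.lookup∘tabulate _ x)) (Vecₚ.[]=⇒lookup x∈)
  ... | yes fx≡j | _ = fx≡j
  ... | no _     | ()

∣partSet∣≡wsum-𝟙 : ∀ {n r} (f : Fin n → Fin r) j →
                   ∣ partSet f j ∣ ≡ wsum (λ x → 𝟙 (f x Fin.≟ j))
∣partSet∣≡wsum-𝟙 f j =
  trans (∣p∣≡wsum-𝟙 (partSet f j))
        (wsum-cong _ _ (λ x → 𝟙-cong (∈-partSet⁻ f) (∈-partSet⁺ f) (x ∈? partSet f j) (f x Fin.≟ j)))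

∣partSet∣-∷ : ∀ {n r} (f : Fin (suc n) → Fin r) j →
              ∣ partSet f j ∣ ≡ 𝟙 (f zero Fin.≟ j) + ∣ partSet (f ∘ suc) j ∣
∣partSet∣-∷ f j =
  trans (∣partSet∣≡wsum-𝟙 f j) (cong (𝟙 (f zero Fin.≟ j) +_) (sym (∣partSet∣≡wsum-𝟙 (f ∘ suc) j)))

wsum-∣partSet∣ : ∀ {n r} (f : Fin n → Fin r) → wsum (λ j → ∣ partSet f j ∣) ≡ n
wsum-∣partSet∣ {zero}  {r} f = trans (wsum-cong {r} _ _ (λ _ → refl)) (wsum-zero r)
wsum-∣partSet∣ {suc n} {r} f = begin
  wsum (λ j → ∣ partSet f j ∣)                                  ≡⟨ wsum-cong {r} _ _ (∣partSet∣-∷ f) ⟩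
  wsum (λ j → 𝟙 (f zero Fin.≟ j) + ∣ partSet (f ∘ suc) j ∣)      ≡⟨ wsum-distrib-+ {r} _ _ ⟩
  wsum (λ j → 𝟙 (f zero Fin.≟ j)) + wsum (λ j → ∣ partSet (f ∘ suc) j ∣)
    ≡⟨ cong₂ _+_ (trans (wsum-cong {r} _ _ (λ j → sym (*-identityʳ _))) (wsum-δ (f zero) (λ _ → 1)))
                 (wsum-∣partSet∣ (f ∘ suc)) ⟩
  suc n                                                          ∎
  where open ≡-Reasoning

-- Binomial coefficients and convexity

C-pascal : ∀ n k → suc n C suc k ≡ n C k + n C suc k
C-pascal n k = sym (nCk+nC[k+1]≡[n+1]C[k+1] n k)

C-monoˡ-suc : ∀ n k → n C k ≤ suc n C k
C-monoˡ-suc n zero    = ≤-refl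
C-monoˡ-suc n (suc k) = ≤-trans (m≤n+m _ _) (≤-reflexive (sym (C-pascal n k)))

C-monoˡ-+ : ∀ d n k → n C k ≤ (d + n) C k
C-monoˡ-+ zero    n k = ≤-refl
C-monoˡ-+ (suc d) n k = ≤-trans (C-monoˡ-+ d n k) (C-monoˡ-suc (d + n) k)

C-𝟙+ : ∀ {P : Set} (d : Dec P) n k → (𝟙 d + n) C suc k ≡ 𝟙 d * (n C k) + n C suc k
C-𝟙+ (yes _) n k = trans (C-pascal n k) (cong (_+ n C suc k) (sym (+-identityʳ (n C k))))
C-𝟙+ (no _)  n k = refl

C-secant-above : ∀ n d k → n C suc k + d * (n C k) ≤ (d + n) C suc k
C-secant-above n zero    k = ≤-reflexive (+-identityʳ _)
C-secant-above n (suc d) k = begin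
  n C suc k + (n C k + d * (n C k))  ≡⟨ swap (n C suc k) (n C k) (d * (n C k)) ⟩
  n C k + (n C suc k + d * (n C k))  ≤⟨ +-mono-≤ (C-monoˡ-+ d n k) (C-secant-above n d k) ⟩
  (d + n) C k + (d + n) C suc k      ≡⟨ C-pascal (d + n) k ⟨
  (suc d + n) C suc k                ∎
  where
  open ≤-Reasoning
  swap : ∀ a b c → a + (b + c) ≡ b + (a + c)
  swap = solve-∀

C-secant-below : ∀ n d k → (d + n) C suc k ≤ n C suc k + d * ((d + n) C k)
C-secant-below n zero    k = ≤-reflexive (sym (+-identityʳ _))
C-secant-below n (suc d) k = begin
  (suc d + n) C suc k                                   ≡⟨ C-pascal (d + n) k ⟩
  (d + n) C k + (d + n) C suc k                         ≤⟨ +-monoʳ-≤ ((d + n) C k) (C-secant-below n d k) ⟩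
  (d + n) C k + (n C suc k + d * ((d + n) C k))         ≤⟨ +-mono-≤ (C-monoˡ-suc (d + n) k)
                                                             (+-monoʳ-≤ (n C suc k) (*-monoʳ-≤ d (C-monoˡ-suc (d + n) k))) ⟩
  (suc d + n) C k + (n C suc k + d * ((suc d + n) C k)) ≡⟨ swap ((suc d + n) C k) (n C suc k) d ⟩
  n C suc k + suc d * ((suc d + n) C k)                 ∎
  where
  open ≤-Reasoning
  swap : ∀ a b d → a + (b + d * a) ≡ b + (a + d * a)
  swap = solve-∀

-- Convexity of x ↦ x C suc k: the tangent line at L, of slope L C k, lies below it
-- (both sides moved so that no subtraction occurs).
C-tangent : ∀ L x k → L C suc k + x * (L C k) ≤ x C suc k + L * (L C k)
C-tangent L x k with ≤-total L x
... | inj₁ L≤x with d , refl ← m≤n⇒∃[o]m+o≡n L≤x rewrite +-comm L d = begin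
  L C suc k + (d + L) * (L C k)         ≡⟨ shuffle (L C suc k) d L (L C k) ⟩
  (L C suc k + d * (L C k)) + L * (L C k) ≤⟨ +-monoˡ-≤ (L * (L C k)) (C-secant-above L d k) ⟩
  (d + L) C suc k + L * (L C k)         ∎
  where
  open ≤-Reasoning
  shuffle : ∀ a d L b → a + (d + L) * b ≡ (a + d * b) + L * b
  shuffle = solve-∀
... | inj₂ x≤L with d , refl ← m≤n⇒∃[o]m+o≡n x≤L rewrite +-comm x d = begin
  (d + x) C suc k + x * ((d + x) C k)                 ≤⟨ +-monoˡ-≤ (x * ((d + x) C k)) (C-secant-below x d k) ⟩
  (x C suc k + d * ((d + x) C k)) + x * ((d + x) C k) ≡⟨ shuffle (x C suc k) d x ((d + x) C k) ⟩
  x C suc k + (d + x) * ((d + x) C k)                 ∎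
  where
  open ≤-Reasoning
  shuffle : ∀ a d x b → (a + d * b) + x * b ≡ a + (d + x) * b
  shuffle = solve-∀

C-tangent-tight : ∀ L x k → x ≡ L ⊎ x ≡ suc L → x C suc k + L * (L C k) ≡ L C suc k + x * (L C k)
C-tangent-tight L .L       k (inj₁ refl) = refl
C-tangent-tight L .(suc L) k (inj₂ refl) = begin
  suc L C suc k + L * (L C k)         ≡⟨ cong (_+ L * (L C k)) (C-pascal L k) ⟩
  (L C k + L C suc k) + L * (L C k)   ≡⟨ shuffle (L C k) (L C suc k) L ⟩
  L C suc k + suc L * (L C k)         ∎
  where
  open ≡-Reasoning
  shuffle : ∀ a b L → (a + b) + L * a ≡ b + (a + L * a)
  shuffle = solve-∀

wsum-C-tangent : ∀ {c} (s : Fin c → ℕ) L k →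
                 c * (L C suc k) + wsum s * (L C k) ≤ wsum (λ j → s j C suc k) + c * (L * (L C k))
wsum-C-tangent {c} s L k = begin
  c * (L C suc k) + wsum s * (L C k)
    ≡⟨ cong₂ _+_ (wsum-const c _) (wsum-distribʳ-* s (L C k)) ⟨
  wsum {c} (λ _ → L C suc k) + wsum (λ j → s j * (L C k))
    ≡⟨ wsum-distrib-+ {c} (λ _ → L C suc k) _ ⟨
  wsum (λ j → L C suc k + s j * (L C k))
    ≤⟨ wsum-mono-≤ _ _ (λ j → C-tangent L (s j) k) ⟩
  wsum (λ j → s j C suc k + L * (L C k))
    ≡⟨ wsum-distrib-+ (λ j → s j C suc k) _ ⟩
  wsum (λ j → s j C suc k) + wsum {c} (λ _ → L * (L C k))
    ≡⟨ cong (wsum (λ j → s j C suc k) +_) (wsum-const c _) ⟩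
  wsum (λ j → s j C suc k) + c * (L * (L C k)) ∎
  where open ≤-Reasoning

IsBalancedOn : ∀ {n} → ℕ → Subset n → (Fin n → ℕ) → Set
IsBalancedOn L I w = (∀ v → v ∉ I → w v ≡ 0) × (∀ v → v ∈ I → w v ≡ L ⊎ w v ≡ suc L)

wsum-C-balanced : ∀ {n} {I : Subset n} {w : Fin n → ℕ} L k → IsBalancedOn L I w →
                  wsum (λ v → w v C suc k) + ∣ I ∣ * (L * (L C k)) ≡ ∣ I ∣ * (L C suc k) + wsum w * (L C k)
wsum-C-balanced {n} {I} {w} L k (outside-zero , inside-LorL+1) = begin
  wsum (λ v → w v C suc k) + ∣ I ∣ * (L * D)
    ≡⟨ cong (λ i → wsum (λ v → w v C suc k) + i * (L * D)) (∣p∣≡wsum-𝟙 I) ⟩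
  wsum (λ v → w v C suc k) + wsum 𝟙I * (L * D)
    ≡⟨ cong (wsum (λ v → w v C suc k) +_) (wsum-distribʳ-* 𝟙I (L * D)) ⟨
  wsum (λ v → w v C suc k) + wsum (λ v → 𝟙I v * (L * D))
    ≡⟨ wsum-distrib-+ (λ v → w v C suc k) _ ⟨
  wsum (λ v → w v C suc k + 𝟙I v * (L * D))
    ≡⟨ wsum-cong _ _ pointwise ⟩
  wsum (λ v → 𝟙I v * (L C suc k) + w v * D)
    ≡⟨ wsum-distrib-+ (λ v → 𝟙I v * (L C suc k)) _ ⟩
  wsum (λ v → 𝟙I v * (L C suc k)) + wsum (λ v → w v * D)
    ≡⟨ cong₂ _+_ (wsum-distribʳ-* 𝟙I (L C suc k)) (wsum-distribʳ-* w D) ⟩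
  wsum 𝟙I * (L C suc k) + wsum w * D
    ≡⟨ cong (λ i → i * (L C suc k) + wsum w * D) (∣p∣≡wsum-𝟙 I) ⟨
  ∣ I ∣ * (L C suc k) + wsum w * D ∎
  where
  open ≡-Reasoning
  D = L C k
  𝟙I : Fin n → ℕ
  𝟙I v = 𝟙 (v ∈? I)
  pointwise : ∀ v → w v C suc k + 𝟙I v * (L * D) ≡ 𝟙I v * (L C suc k) + w v * D
  pointwise v with v ∈? I
  ... | yes v∈I = trans (cong (w v C suc k +_) (+-identityʳ (L * D)))
                        (trans (C-tangent-tight L (w v) k (inside-LorL+1 v v∈I))
                               (cong (_+ w v * D) (sym (+-identityʳ (L C suc k)))))
  ... | no v∉I rewrite outside-zero v v∉I = refl

balanced-minimises-wsum-C : ∀ {n c} {I : Subset n} {w : Fin n → ℕ} L k → IsBalancedOn L I w →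
                            (s : Fin c → ℕ) → ∣ I ∣ ≡ c → wsum s ≡ wsum w →
                            wsum (λ v → w v C suc k) ≤ wsum (λ j → s j C suc k)
balanced-minimises-wsum-C {c = c} {I} {w} L k balanced s ∣I∣≡c ∑s≡∑w =
  +-cancelʳ-≤ (c * (L * (L C k))) _ _ (begin
    wsum (λ v → w v C suc k) + c * (L * (L C k))   ≡⟨ cong (λ i → _ + i * (L * (L C k))) ∣I∣≡c ⟨
    wsum (λ v → w v C suc k) + ∣ I ∣ * (L * (L C k)) ≡⟨ wsum-C-balanced L k balanced ⟩
    ∣ I ∣ * (L C suc k) + wsum w * (L C k)
      ≡⟨ cong₂ (λ i t → i * (L C suc k) + t * (L C k)) ∣I∣≡c (sym ∑s≡∑w) ⟩
    c * (L C suc k) + wsum s * (L C k)              ≤⟨ wsum-C-tangent s L k ⟩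
    wsum (λ j → s j C suc k) + c * (L * (L C k))   ∎)
  where open ≤-Reasoning

-- Counting subsets and cliques

module _ {A B : Set} {P : Pred B 0ℓ} (P? : Decidable P) where

  length-filter-map : (g : A → B) (xs : List A) → length (filter P? (List.map g xs)) ≡ length (filter (P? ∘ g) xs)
  length-filter-map g []       = refl
  length-filter-map g (x ∷ xs) with does (P? (g x))
  ... | true  = cong suc (length-filter-map g xs)
  ... | false = length-filter-map g xs

module _ {A : Set} {P Q : Pred A 0ℓ} (P? : Decidable P) (Q? : Decidable Q) (P⇒Q : ∀ {x} → P x → Q x) where

  length-filter-mono : (xs : List A) → length (filter P? xs) ≤ length (filter Q? xs)
  length-filter-mono []       = z≤n
  length-filter-mono (x ∷ xs) with P? x | Q? x
  ... | yes _  | yes _  = s≤s (length-filter-mono xs)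
  ... | yes px | no ¬qx = ⊥-elim (¬qx (P⇒Q px))
  ... | no _   | yes _  = m≤n⇒m≤1+n (length-filter-mono xs)
  ... | no _   | no _   = length-filter-mono xs

  length-filter-mono-< : ∀ {y} {xs : List A} → y ∈ₗ xs → Q y → ¬ P y →
                         length (filter P? xs) < length (filter Q? xs)
  length-filter-mono-< {xs = x ∷ xs} (here refl) qx ¬px with P? x | Q? x
  ... | yes px | _      = ⊥-elim (¬px px)
  ... | no _   | yes _  = s≤s (length-filter-mono xs)
  ... | no _   | no ¬qx = ⊥-elim (¬qx qx)
  length-filter-mono-< {xs = x ∷ xs} (there y∈) qy ¬py with P? x | Q? x
  ... | yes _  | yes _  = s≤s (length-filter-mono-< y∈ qy ¬py)
  ... | yes px | no ¬qx = ⊥-elim (¬qx (P⇒Q px))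
  ... | no _   | yes _  = m≤n⇒m≤1+n (length-filter-mono-< y∈ qy ¬py)
  ... | no _   | no _   = length-filter-mono-< y∈ qy ¬py

∈-allSubsets : ∀ {N} (S : Subset N) → S ∈ₗ allSubsets N
∈-allSubsets []            = here refl
∈-allSubsets (inside ∷ S)  = Anyₚ.++⁺ˡ (Anyₚ.map⁺ (Any.map (cong (inside ∷_)) (∈-allSubsets S)))
∈-allSubsets (outside ∷ S) = Anyₚ.++⁺ʳ _ (Anyₚ.map⁺ (Any.map (cong (outside ∷_)) (∈-allSubsets S)))

countSubsets : ∀ {N} {P : Pred (Subset N) 0ℓ} → Decidable P → ℕ
countSubsets {N} P? = length (filter P? (allSubsets N))

module _ {N} {P : Pred (Subset N) 0ℓ} (P? : Decidable P) where

  countSubsets-none : (∀ S → ¬ P S) → countSubsets P? ≡ 0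
  countSubsets-none ¬P = cong length (filter-none P? (All.universal ¬P (allSubsets N)))

  module _ {Q : Pred (Subset N) 0ℓ} (Q? : Decidable Q) where

    countSubsets-cong : P ≐ Q → countSubsets P? ≡ countSubsets Q?
    countSubsets-cong P≐Q = cong length (filter-≐ P? Q? P≐Q (allSubsets N))

    countSubsets-mono-< : (∀ {S} → P S → Q S) → ∀ S → Q S → ¬ P S → countSubsets P? < countSubsets Q?
    countSubsets-mono-< P⇒Q S = length-filter-mono-< P? Q? P⇒Q (∈-allSubsets S)

countSubsets-∷ : ∀ {N} {P : Pred (Subset (suc N)) 0ℓ} (P? : Decidable P) →
                 countSubsets P? ≡ countSubsets (P? ∘ (inside ∷_)) + countSubsets (P? ∘ (outside ∷_))
countSubsets-∷ {N} P? = begin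
  length (filter P? (List.map (inside ∷_) Ss ++ List.map (outside ∷_) Ss))
    ≡⟨ cong length (filter-++ P? (List.map (inside ∷_) Ss) _) ⟩
  length (filter P? (List.map (inside ∷_) Ss) ++ filter P? (List.map (outside ∷_) Ss))
    ≡⟨ length-++ (filter P? (List.map (inside ∷_) Ss)) ⟩
  length (filter P? (List.map (inside ∷_) Ss)) + length (filter P? (List.map (outside ∷_) Ss))
    ≡⟨ cong₂ _+_ (length-filter-map P? _ Ss) (length-filter-map P? _ Ss) ⟩
  countSubsets (P? ∘ (inside ∷_)) + countSubsets (P? ∘ (outside ∷_)) ∎
  where
  open ≡-Reasoning
  Ss = allSubsets N

π-cong : ∀ {N} (G H : Graph N) k → IsKClique G k ≐ IsKClique H k → π k G ≡ π k H
π-cong G H k = countSubsets-cong (isKClique? G k) (isKClique? H k)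

π-mono-< : ∀ {N} (G H : Graph N) k → (∀ {S} → IsKClique G k S → IsKClique H k S) →
           ∀ S → IsKClique H k S → ¬ IsKClique G k S → π k G < π k H
π-mono-< G H k = countSubsets-mono-< (isKClique? G k) (isKClique? H k)

sized-⊆? : ∀ {N} k (S : Subset N) → Decidable (λ T → ∣ T ∣ ≡ k × T ⊆ S)
sized-⊆? k S T = (∣ T ∣ ≟ k) ×-dec (T ⊆? S)

countSubsets-⊆≡C : ∀ {N} (S : Subset N) k → countSubsets (sized-⊆? k S) ≡ ∣ S ∣ C k
countSubsets-⊆≡C []            zero    = refl
countSubsets-⊆≡C []            (suc k) = refl
countSubsets-⊆≡C (s ∷ S) k = begin
  countSubsets (sized-⊆? k (s ∷ S))
    ≡⟨ countSubsets-∷ (sized-⊆? k (s ∷ S)) ⟩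
  countSubsets (sized-⊆? k (s ∷ S) ∘ (inside ∷_)) + countSubsets (sized-⊆? k (s ∷ S) ∘ (outside ∷_))
    ≡⟨ cong (countSubsets (sized-⊆? k (s ∷ S) ∘ (inside ∷_)) +_)
            (countSubsets-cong _ (sized-⊆? k S) (map₂ drop-∷-⊆ , map₂ out⊆)) ⟩
  countSubsets (sized-⊆? k (s ∷ S) ∘ (inside ∷_)) + countSubsets (sized-⊆? k S)
    ≡⟨ cong (countSubsets (sized-⊆? k (s ∷ S) ∘ (inside ∷_)) +_) (countSubsets-⊆≡C S k) ⟩
  countSubsets (sized-⊆? k (s ∷ S) ∘ (inside ∷_)) + ∣ S ∣ C k
    ≡⟨ with-head s k ⟩
  ∣ s ∷ S ∣ C k ∎
  where
  open ≡-Reasoning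
  with-head : ∀ s k → countSubsets (sized-⊆? k (s ∷ S) ∘ (inside ∷_)) + ∣ S ∣ C k ≡ ∣ s ∷ S ∣ C k
  with-head outside k       =
    cong (_+ ∣ S ∣ C k) (countSubsets-none (sized-⊆? k (outside ∷ S) ∘ (inside ∷_))
                                           λ _ (_ , iT⊆oS) → contradiction (iT⊆oS here) λ ())
  with-head inside  zero    = cong (_+ 1) (countSubsets-none (sized-⊆? 0 (inside ∷ S) ∘ (inside ∷_)) λ _ ())
  with-head inside  (suc k) = begin
    countSubsets (sized-⊆? (suc k) (inside ∷ S) ∘ (inside ∷_)) + ∣ S ∣ C suc k
      ≡⟨ cong (_+ ∣ S ∣ C suc k) (countSubsets-cong _ (sized-⊆? k S) (map suc-injective drop-∷-⊆ , map (cong suc) in⊆in)) ⟩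
    countSubsets (sized-⊆? k S) + ∣ S ∣ C suc k
      ≡⟨ cong (_+ ∣ S ∣ C suc k) (countSubsets-⊆≡C S k) ⟩
    ∣ S ∣ C k + ∣ S ∣ C suc k
      ≡⟨ C-pascal ∣ S ∣ k ⟨
    suc ∣ S ∣ C suc k ∎

colourCliques : ∀ {N c} → (Fin N → Fin c) → Graph N
colourCliques f = record
  { Adj    = λ x y → x ≢ y × f x ≡ f y
  ; adj?   = λ x y → ¬? (x Fin.≟ y) ×-dec (f x Fin.≟ f y)
  ; sym    = map (_∘ sym) sym
  ; irrefl = λ (x≢x , _) → x≢x refl
  }

module _ {N c} (f : Fin (suc N) → Fin c) (k : ℕ) where

  clique-inside∷ : (λ T → IsKClique (colourCliques f) (suc k) (inside ∷ T)) ≐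
                   (λ T → ∣ T ∣ ≡ k × T ⊆ partSet (f ∘ suc) (f zero))
  clique-inside∷ = to , from
    where
    to : ∀ {T} → IsKClique (colourCliques f) (suc k) (inside ∷ T) → ∣ T ∣ ≡ k × T ⊆ partSet (f ∘ suc) (f zero)
    to (∣T∣≡k , clique) =
      suc-injective ∣T∣≡k , λ x∈ → ∈-partSet⁺ (f ∘ suc) (sym (proj₂ (clique zero _ here (there x∈) λ ())))
    from : ∀ {T} → ∣ T ∣ ≡ k × T ⊆ partSet (f ∘ suc) (f zero) → IsKClique (colourCliques f) (suc k) (inside ∷ T)
    from {T} (∣T∣≡k , T⊆) =
      cong suc ∣T∣≡k , λ x y x∈ y∈ x≢y → x≢y , trans (colour-f0 x x∈) (sym (colour-f0 y y∈))
      where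
      colour-f0 : ∀ x → x ∈ inside ∷ T → f x ≡ f zero
      colour-f0 zero    here       = refl
      colour-f0 (suc x) (there x∈) = ∈-partSet⁻ (f ∘ suc) (T⊆ x∈)

  clique-outside∷ : (λ T → IsKClique (colourCliques f) k (outside ∷ T)) ≐ IsKClique (colourCliques (f ∘ suc)) k
  clique-outside∷ = to , from
    where
    to : ∀ {T} → IsKClique (colourCliques f) k (outside ∷ T) → IsKClique (colourCliques (f ∘ suc)) k T
    to (∣T∣≡k , clique) = ∣T∣≡k , λ x y x∈ y∈ x≢y →
      x≢y , proj₂ (clique (suc x) (suc y) (there x∈) (there y∈) (x≢y ∘ Finₚ.suc-injective))
    from : ∀ {T} → IsKClique (colourCliques (f ∘ suc)) k T → IsKClique (colourCliques f) k (outside ∷ T)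
    from (∣T∣≡k , clique) = ∣T∣≡k , λ where
      (suc x) (suc y) (there x∈) (there y∈) x≢y → x≢y , proj₂ (clique x y x∈ y∈ (x≢y ∘ cong suc))

π-colourCliques : ∀ {N c} (f : Fin N → Fin c) k →
                  π (suc k) (colourCliques f) ≡ wsum (λ j → ∣ partSet f j ∣ C suc k)
π-colourCliques {zero}  {c} f k = sym (trans (wsum-cong {c} _ _ (λ _ → refl)) (wsum-zero c))
π-colourCliques {suc N} {c} f k = begin
  π (suc k) (colourCliques f)
    ≡⟨ countSubsets-∷ clique? ⟩
  countSubsets (clique? ∘ (inside ∷_)) + countSubsets (clique? ∘ (outside ∷_))
    ≡⟨ cong₂ _+_ (countSubsets-cong _ (sized-⊆? k (partSet f′ (f zero))) (clique-inside∷ f k))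
                 (countSubsets-cong _ (isKClique? (colourCliques f′) (suc k)) (clique-outside∷ f (suc k))) ⟩
  countSubsets (sized-⊆? k (partSet f′ (f zero))) + π (suc k) (colourCliques f′)
    ≡⟨ cong₂ _+_ (countSubsets-⊆≡C (partSet f′ (f zero)) k) (π-colourCliques f′ k) ⟩
  ∣ partSet f′ (f zero) ∣ C k + wsum (λ j → ∣ partSet f′ j ∣ C suc k)
    ≡⟨ cong (_+ wsum (λ j → ∣ partSet f′ j ∣ C suc k)) (wsum-δ (f zero) (λ j → ∣ partSet f′ j ∣ C k)) ⟨
  wsum (λ j → 𝟙 (f zero Fin.≟ j) * (∣ partSet f′ j ∣ C k)) + wsum (λ j → ∣ partSet f′ j ∣ C suc k)
    ≡⟨ wsum-distrib-+ {c} _ _ ⟨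
  wsum (λ j → 𝟙 (f zero Fin.≟ j) * (∣ partSet f′ j ∣ C k) + ∣ partSet f′ j ∣ C suc k)
    ≡⟨ wsum-cong {c} _ _ (λ j → trans (cong (_C suc k) (∣partSet∣-∷ f j)) (C-𝟙+ (f zero Fin.≟ j) _ k)) ⟨
  wsum (λ j → ∣ partSet f j ∣ C suc k) ∎
  where
  open ≡-Reasoning
  f′ = f ∘ suc
  clique? = isKClique? (colourCliques f) (suc k)

-- Blow-ups

owner-↑ˡ : ∀ {n} (w : Fin (suc n) → ℕ) i → owner w (i ↑ˡ wsum (w ∘ suc)) ≡ zero
owner-↑ˡ w i rewrite Finₚ.splitAt-↑ˡ (w zero) i (wsum (w ∘ suc)) = refl

owner-↑ʳ : ∀ {n} (w : Fin (suc n) → ℕ) j → owner w (w zero ↑ʳ j) ≡ suc (owner (w ∘ suc) j)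
owner-↑ʳ w j rewrite Finₚ.splitAt-↑ʳ (w zero) (wsum (w ∘ suc)) j = refl

∣partSet-owner∣ : ∀ {n} (w : Fin n → ℕ) v → ∣ partSet (owner w) v ∣ ≡ w v
∣partSet-owner∣ {suc n} w v = begin
  ∣ partSet (owner w) v ∣
    ≡⟨ ∣partSet∣≡wsum-𝟙 (owner w) v ⟩
  wsum (λ x → 𝟙 (owner w x Fin.≟ v))
    ≡⟨ wsum-↑ (w zero) (wsum w′) _ ⟩
  wsum (λ i → 𝟙 (owner w (i ↑ˡ wsum w′) Fin.≟ v)) + wsum (λ j → 𝟙 (owner w (w zero ↑ʳ j) Fin.≟ v))
    ≡⟨ cong₂ _+_ (wsum-cong _ _ (λ i → cong (λ o → 𝟙 (o Fin.≟ v)) (owner-↑ˡ w i)))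
                 (wsum-cong _ _ (λ j → cong (λ o → 𝟙 (o Fin.≟ v)) (owner-↑ʳ w j))) ⟩
  wsum {w zero} (λ _ → 𝟙 (zero Fin.≟ v)) + wsum (λ j → 𝟙 (suc (owner w′ j) Fin.≟ v))
    ≡⟨ blocks v ⟩
  w v ∎
  where
  open ≡-Reasoning
  w′ = w ∘ suc
  blocks : ∀ v → wsum {w zero} (λ _ → 𝟙 (zero Fin.≟ v)) + wsum (λ j → 𝟙 (suc (owner w′ j) Fin.≟ v))
                 ≡ w v
  blocks zero    = trans (cong₂ _+_ (trans (wsum-const (w zero) 1) (*-identityʳ (w zero)))
                                    (trans (wsum-cong {wsum w′} _ (λ _ → 0) (λ _ → refl)) (wsum-zero (wsum w′))))
                         (+-identityʳ (w zero))
  blocks (suc v) = cong₂ _+_ (wsum-zero (w zero))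
                             (trans (wsum-cong _ _ λ j → 𝟙-cong Finₚ.suc-injective (cong suc) _ (owner w′ j Fin.≟ v))
                                    (trans (sym (∣partSet∣≡wsum-𝟙 (owner w′) v)) (∣partSet-owner∣ w′ v)))

0<weight-owner : ∀ {n} (w : Fin n → ℕ) x → 0 < w (owner w x)
0<weight-owner w x =
  subst (0 <_) (∣partSet-owner∣ w (owner w x)) (≤-<-trans z≤n (x∈p⇒∣p-x∣<∣p∣ (∈-partSet⁺ (owner w) refl)))

-- The clique is made of a vertex y₀ of Kᵘ together with k − 1 vertices of Kᵛ.
blowup-clique-across : ∀ {n} (G : Graph n) (w : Fin n → ℕ) {u v} → Adj G u v →
                       ∀ k → 2 ≤ k → k ≤ w v → 0 < w u →
                       Σ[ B ∈ Subset (wsum w) ] (IsKClique (blowup G w) k B ×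
                         Σ[ y ∈ Fin (wsum w) ] Σ[ z ∈ Fin (wsum w) ]
                           (y ∈ B × z ∈ B × owner w y ≡ u × owner w z ≡ v))
blowup-clique-across G w {u} {v} uv k 2≤k k≤wv 0<wu =
  B , (∣B∣≡k , B-clique) , y₀ , z , y₀∈B , z∈B , owner-y₀ , owner-z
  where
  Kᵛ = partSet (owner w) v
  y₀∈Kᵘ = 0<∣p∣⇒Nonempty (partSet (owner w) u) (subst (0 <_) (sym (∣partSet-owner∣ w u)) 0<wu)
  y₀ = proj₁ y₀∈Kᵘ
  owner-y₀ : owner w y₀ ≡ u
  owner-y₀ = ∈-partSet⁻ (owner w) (proj₂ y₀∈Kᵘ)
  A = Kᵛ ∪ ⁅ y₀ ⁆
  k≤∣A∣ : k ≤ ∣ A ∣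
  k≤∣A∣ = ≤-trans k≤wv (≤-trans (≤-reflexive (sym (∣partSet-owner∣ w v))) (∣p∣≤∣p∪q∣ Kᵛ ⁅ y₀ ⁆))
  chosen = ∃-⊆-∋-of-size A (q⊆p∪q Kᵛ ⁅ y₀ ⁆ (x∈⁅x⁆ y₀)) k (≤-trans (s≤s z≤n) 2≤k) k≤∣A∣
  B = proj₁ chosen
  B⊆A = proj₁ (proj₂ chosen)
  y₀∈B = proj₁ (proj₂ (proj₂ chosen))
  ∣B∣≡k = proj₂ (proj₂ (proj₂ chosen))
  in-Kᵛ-or-y₀ : ∀ {x} → x ∈ B → owner w x ≡ v ⊎ x ≡ y₀
  in-Kᵛ-or-y₀ x∈B = Sum.map (∈-partSet⁻ (owner w)) (x∈⁅y⁆⇒x≡y y₀) (x∈p∪q⁻ Kᵛ ⁅ y₀ ⁆ (B⊆A x∈B))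
  owner∈uv : ∀ {x} → x ∈ B → owner w x ≡ v ⊎ owner w x ≡ u
  owner∈uv x∈B = Sum.map₂ (λ { refl → owner-y₀ }) (in-Kᵛ-or-y₀ x∈B)
  B-clique : IsClique (blowup G w) B
  B-clique x y x∈B y∈B x≢y = x≢y , related (owner∈uv x∈B) (owner∈uv y∈B)
    where
    related : ∀ {o o′} → o ≡ v ⊎ o ≡ u → o′ ≡ v ⊎ o′ ≡ u → o ≡ o′ ⊎ Adj G o o′
    related (inj₁ refl) (inj₁ refl) = inj₁ refl
    related (inj₂ refl) (inj₂ refl) = inj₁ refl
    related (inj₁ refl) (inj₂ refl) = inj₂ (Graph.sym G uv)
    related (inj₂ refl) (inj₁ refl) = inj₂ uv
  other = ∃-∈-≢ B y₀ (subst (2 ≤_) (sym ∣B∣≡k) 2≤k)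
  z = proj₁ other
  z∈B = proj₁ (proj₂ other)
  owner-z : owner w z ≡ v
  owner-z = [ id , (λ z≡y₀ → ⊥-elim (proj₂ (proj₂ other) z≡y₀)) ]′ (in-Kᵛ-or-y₀ z∈B)

module _ {n c} (G : Graph n) (w : Fin n → ℕ) (g : Fin n → Fin c)
         (g-sep : ∀ u v → u ≢ v → g u ≡ g v → Adj G u v) where

  clique-colourCliques⇒clique-blowup : ∀ {k S} → IsKClique (colourCliques (g ∘ owner w)) k S →
                                       IsKClique (blowup G w) k S
  clique-colourCliques⇒clique-blowup (∣S∣≡k , clique) =
    ∣S∣≡k , λ x y x∈ y∈ x≢y → x≢y , adjacent (proj₂ (clique x y x∈ y∈ x≢y))
    where
    adjacent : ∀ {x y} → g (owner w x) ≡ g (owner w y) → owner w x ≡ owner w y ⊎ Adj G (owner w x) (owner w y)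
    adjacent {x} {y} same-colour with owner w x Fin.≟ owner w y
    ... | yes same-owner = inj₁ same-owner
    ... | no  owners≢    = inj₂ (g-sep _ _ owners≢ same-colour)

  π-colourCliques<π-blowup : ∀ {u v} → Adj G u v → g u ≢ g v → ∀ k → 2 ≤ k → k ≤ w v → 0 < w u →
                             π k (colourCliques (g ∘ owner w)) < π k (blowup G w)
  π-colourCliques<π-blowup {u} {v} uv gu≢gv k 2≤k k≤wv 0<wu
    with B , B-clique , y , z , y∈B , z∈B , owner-y≡u , owner-z≡v
           ← blowup-clique-across G w uv k 2≤k k≤wv 0<wu
    = π-mono-< (colourCliques (g ∘ owner w)) (blowup G w) k clique-colourCliques⇒clique-blowup B B-clique
               λ (_ , monochromatic) → gu≢gv (begin
                 g u            ≡⟨ cong g owner-y≡u ⟨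
                 g (owner w y)  ≡⟨ proj₂ (monochromatic y z y∈B z∈B y≢z) ⟩
                 g (owner w z)  ≡⟨ cong g owner-z≡v ⟩
                 g v            ∎)
    where
    open ≡-Reasoning
    y≢z : y ≢ z
    y≢z y≡z = Graph.irrefl G (subst₂ (Adj G) (trans (sym owner-y≡u) (cong (owner w) y≡z)) (sym owner-z≡v) uv)

π-blowup-independent : ∀ {n} (G : Graph n) {I : Subset n} → IsIndependent G I → (w : Fin n → ℕ) →
                       (∀ v → v ∉ I → w v ≡ 0) →
                       ∀ k → π (suc k) (blowup G w) ≡ wsum (λ v → w v C suc k)
π-blowup-independent G {I} I-independent w outside-zero k = begin
  π (suc k) (blowup G w)
    ≡⟨ π-cong (blowup G w) (colourCliques (owner w)) (suc k) (to , from) ⟩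
  π (suc k) (colourCliques (owner w))
    ≡⟨ π-colourCliques (owner w) k ⟩
  wsum (λ v → ∣ partSet (owner w) v ∣ C suc k)
    ≡⟨ wsum-cong _ _ (λ v → cong (_C suc k) (∣partSet-owner∣ w v)) ⟩
  wsum (λ v → w v C suc k) ∎
  where
  open ≡-Reasoning
  owner∈I : ∀ x → owner w x ∈ I
  owner∈I x with owner w x ∈? I
  ... | yes o∈I = o∈I
  ... | no  o∉I = ⊥-elim (<-irrefl (sym (outside-zero _ o∉I)) (0<weight-owner w x))
  to : ∀ {S} → IsKClique (blowup G w) (suc k) S → IsKClique (colourCliques (owner w)) (suc k) S
  to (∣S∣≡k , clique) = ∣S∣≡k , λ x y x∈ y∈ x≢y → case clique x y x∈ y∈ x≢y of λ where
    (_ , inj₁ same-owner) → x≢y , same-owner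
    (_ , inj₂ adj)        → ⊥-elim (I-independent _ _ (owner∈I x) (owner∈I y) adj)
  from : ∀ {S} → IsKClique (colourCliques (owner w)) (suc k) S → IsKClique (blowup G w) (suc k) S
  from = clique-colourCliques⇒clique-blowup G w id (λ _ _ u≢v u≡v → ⊥-elim (u≢v u≡v))

ceilDiv≤1+⌊⌋ : ∀ m a .{{_ : NonZero a}} → ceilDiv m a ≤ suc (m / a)
ceilDiv≤1+⌊⌋ m a = begin
  (m + (a ∸ 1)) / a     ≤⟨ /-monoˡ-≤ a (+-monoʳ-≤ m (m∸n≤m a 1)) ⟩
  (m + a) / a           ≡⟨ m/n≡1+[m∸n]/n (m≤n+m a m) ⟩
  suc ((m + a ∸ a) / a) ≡⟨ cong (λ x → suc (x / a)) (m+n∸n≡m m a) ⟩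
  suc (m / a)           ∎
  where open ≤-Reasoning

ceilDiv≡⌊⌋⊎1+⌊⌋ : ∀ m a .{{_ : NonZero a}} → ceilDiv m a ≡ m / a ⊎ ceilDiv m a ≡ suc (m / a)
ceilDiv≡⌊⌋⊎1+⌊⌋ m a with m≤n⇒m<n∨m≡n (ceilDiv≤1+⌊⌋ m a)
... | inj₂ ceil≡1+floor = inj₂ ceil≡1+floor
... | inj₁ ceil<1+floor = inj₁ (≤-antisym (≤-pred ceil<1+floor) (/-monoˡ-≤ a (m≤m+n m (a ∸ 1))))

uniform⇒balanced : ∀ {n m} {U : Subset n} {w : Fin n → ℕ} (uniform : IsUniformOn m U w) →
                   IsBalancedOn (_/_ m ∣ U ∣ {{proj₁ uniform}}) U w
uniform⇒balanced {m = m} {U} {w} (nonzero , outside-zero , inside-values) = outside-zero , floor-or-ceil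
  where
  instance _ = nonzero
  floor-or-ceil : ∀ v → v ∈ U → w v ≡ m / ∣ U ∣ ⊎ w v ≡ suc (m / ∣ U ∣)
  floor-or-ceil v v∈U with inside-values v v∈U
  ... | inj₁ floor = inj₁ floor
  ... | inj₂ ceil  = Sum.map (trans ceil) (trans ceil) (ceilDiv≡⌊⌋⊎1+⌊⌋ m ∣ U ∣)

uniform⇒k≤weight : ∀ {n m k} {U : Subset n} {w : Fin n → ℕ} → IsUniformOn m U w → k * ∣ U ∣ ≤ m →
                   ∀ v → v ∈ U → k ≤ w v
uniform⇒k≤weight {m = m} {k} {U} {w} uniform k∣U∣≤m v v∈U = begin
  k                 ≡⟨ m*n/n≡m k ∣ U ∣ ⟨
  k * ∣ U ∣ / ∣ U ∣ ≤⟨ /-monoˡ-≤ ∣ U ∣ k∣U∣≤m ⟩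
  m / ∣ U ∣         ≤⟨ [ ≤-reflexive ∘ sym , ≤-trans (n≤1+n _) ∘ ≤-reflexive ∘ sym ]′
                         (proj₂ (uniform⇒balanced uniform) v v∈U) ⟩
  w v               ∎
  where
  open ≤-Reasoning
  instance _ = proj₁ uniform

-- Complete multipartite graphs

module CompleteMultipartite {n r} (G : Graph n) (part : Fin n → Fin r)
                            (multipartite : IsCompleteMultipartiteBy G part) where

  P : Fin r → Subset n
  P = partSet part

  adj⇒part≢ : ∀ {x y} → Adj G x y → part x ≢ part y
  adj⇒part≢ {x} {y} = proj₁ (proj₂ multipartite x y)

  part≢⇒adj : ∀ {x y} → part x ≢ part y → Adj G x y
  part≢⇒adj {x} {y} = proj₂ (proj₂ multipartite x y)

  P-independent : ∀ p → IsIndependent G (P p)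
  P-independent p x y x∈ y∈ xy = adj⇒part≢ xy (trans (∈-partSet⁻ part x∈) (sym (∈-partSet⁻ part y∈)))

  P-nonempty : ∀ p → Nonempty (P p)
  P-nonempty p = let v , part-v≡p = proj₁ multipartite p in v , ∈-partSet⁺ part part-v≡p

  ∈-∩P? : ∀ T p x → Dec (x ∈ T × part x ≡ p)
  ∈-∩P? T p x = (x ∈? T) ×-dec (part x Fin.≟ p)

  clique-meets-part-once : ∀ {T} → IsClique G T → ∀ p → wsum (λ x → 𝟙 (∈-∩P? T p x)) ≤ 1
  clique-meets-part-once {T} clique p = wsum-𝟙≤1 (∈-∩P? T p) λ where
    x y (x∈T , part-x≡p) (y∈T , part-y≡p) → case x Fin.≟ y of λ where
      (yes x≡y) → x≡y
      (no x≢y)  → ⊥-elim (adj⇒part≢ (clique x y x∈T y∈T x≢y) (trans part-x≡p (sym part-y≡p)))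

  two-parts-kCliqueIndependent : ∀ {k} → 3 ≤ k → ∀ p q → IsKCliqueIndependent G k (P p ∪ P q)
  two-parts-kCliqueIndependent {k} 3≤k p q T T⊆ (∣T∣≡k , clique) = <⇒≱ 3≤k (subst (_≤ 2) ∣T∣≡k ∣T∣≤2)
    where
    in-p-or-q : ∀ {x} → x ∈ T → (x ∈ T × part x ≡ p) ⊎ (x ∈ T × part x ≡ q)
    in-p-or-q x∈T =
      Sum.map ((x∈T ,_) ∘ ∈-partSet⁻ part) ((x∈T ,_) ∘ ∈-partSet⁻ part) (x∈p∪q⁻ (P p) (P q) (T⊆ x∈T))
    ∣T∣≤2 : ∣ T ∣ ≤ 2
    ∣T∣≤2 = begin
      ∣ T ∣
        ≡⟨ ∣p∣≡wsum-𝟙 T ⟩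
      wsum (λ x → 𝟙 (x ∈? T))
        ≤⟨ wsum-mono-≤ _ _ (λ x → 𝟙-⊎ in-p-or-q (x ∈? T) (∈-∩P? T p x) (∈-∩P? T q x)) ⟩
      wsum (λ x → 𝟙 (∈-∩P? T p x) + 𝟙 (∈-∩P? T q x))
        ≡⟨ wsum-distrib-+ (λ x → 𝟙 (∈-∩P? T p x)) _ ⟩
      wsum (λ x → 𝟙 (∈-∩P? T p x)) + wsum (λ x → 𝟙 (∈-∩P? T q x))
        ≤⟨ +-mono-≤ (clique-meets-part-once clique p) (clique-meets-part-once clique q) ⟩
      2 ∎
      where open ≤-Reasoning

  P⊂P∪P : ∀ {p q} → p ≢ q → P p ⊂ P p ∪ P q
  P⊂P∪P {p} {q} p≢q =
    let z , z∈Pq = P-nonempty q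
    in p⊆p∪q (P q) , z , q⊆p∪q (P p) (P q) z∈Pq ,
       λ z∈Pp → p≢q (trans (sym (∈-partSet⁻ part z∈Pp)) (∈-partSet⁻ part z∈Pq))

  maxKCliqueIndependent-⊈P : ∀ {k I′} → 3 ≤ k → IsMaxKCliqueIndependent G k I′ →
                             ∀ {p q} → p ≢ q → ¬ (I′ ⊆ P p)
  maxKCliqueIndependent-⊈P {k} {I′} 3≤k (_ , maximal) {p} {q} p≢q I′⊆Pp = <-irrefl refl (begin-strict
    ∣ I′ ∣          ≤⟨ p⊆q⇒∣p∣≤∣q∣ I′⊆Pp ⟩
    ∣ P p ∣         <⟨ p⊂q⇒∣p∣<∣q∣ (P⊂P∪P p≢q) ⟩
    ∣ P p ∪ P q ∣   ≤⟨ maximal _ (two-parts-kCliqueIndependent 3≤k p q) ⟩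
    ∣ I′ ∣          ∎)
    where open ≤-Reasoning

  maxKCliqueIndependent-meets-two-parts : ∀ {k I′} → 3 ≤ k → IsMaxKCliqueIndependent G k I′ →
    ∀ {p₀ q₀} → p₀ ≢ q₀ →
    Σ[ u ∈ Fin n ] Σ[ v ∈ Fin n ] (u ∈ I′ × v ∈ I′ × part u ≢ part v × part u ≢ p₀)
  maxKCliqueIndependent-meets-two-parts {k} {I′} 3≤k I′-max {p₀} {q₀} p₀≢q₀
    with Finₚ.any? (λ x → Finₚ.any? λ y → (x ∈? I′) ×-dec (y ∈? I′) ×-dec ¬? (part x Fin.≟ part y))
  ... | yes (x , y , x∈ , y∈ , px≢py) with part x Fin.≟ p₀
  ...   | yes px≡p₀ = y , x , y∈ , x∈ , px≢py ∘ sym , λ py≡p₀ → px≢py (trans px≡p₀ (sym py≡p₀))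
  ...   | no  px≢p₀ = x , y , x∈ , y∈ , px≢py , px≢p₀
  maxKCliqueIndependent-meets-two-parts {k} {I′} 3≤k I′-max {p₀} {q₀} p₀≢q₀
      | no ∄pair = ⊥-elim (maxKCliqueIndependent-⊈P 3≤k I′-max (proj₂ (another p)) I′⊆Pp)
    where
    same-part : ∀ {x y} → x ∈ I′ → y ∈ I′ → part x ≡ part y
    same-part {x} {y} x∈ y∈ with part x Fin.≟ part y
    ... | yes eq     = eq
    ... | no parts≢ = ⊥-elim (∄pair (x , y , x∈ , y∈ , parts≢))
    p : Fin r
    p with nonempty? I′
    ... | yes (x , _) = part x
    ... | no  _       = p₀
    I′⊆Pp : I′ ⊆ P p
    I′⊆Pp {y} y∈ with nonempty? I′
    ... | yes (x , x∈) = ∈-partSet⁺ part (same-part y∈ x∈)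
    ... | no  empty    = ⊥-elim (empty (y , y∈))
    another : ∀ p → ∃ λ q → p ≢ q
    another p with p Fin.≟ p₀
    ... | yes refl = q₀ , p₀≢q₀
    ... | no  p≢p₀ = p₀ , p≢p₀

  earlier-in-part? : ∀ y z → Dec (toℕ z < toℕ y × part z ≡ part y)
  earlier-in-part? y z = (toℕ z <? toℕ y) ×-dec (part z Fin.≟ part y)

  rank : Fin n → ℕ
  rank y = wsum (λ z → 𝟙 (earlier-in-part? y z))

  not-earlier-than-itself : ∀ y → ¬ (toℕ y < toℕ y × part y ≡ part y)
  not-earlier-than-itself y (y<y , _) = <-irrefl refl y<y

  rank<∣P∣ : ∀ y → rank y < ∣ P (part y) ∣
  rank<∣P∣ y = subst (rank y <_) (sym (∣partSet∣≡wsum-𝟙 part (part y)))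
    (wsum-mono-< _ _ (λ z → 𝟙-mono proj₂ (earlier-in-part? y z) (part z Fin.≟ part y)) y
                 (𝟙-no<𝟙-yes (not-earlier-than-itself y) refl (earlier-in-part? y y) (part y Fin.≟ part y)))

  rank-mono-< : ∀ {y y′} → part y ≡ part y′ → toℕ y < toℕ y′ → rank y < rank y′
  rank-mono-< {y} {y′} same-part y<y′ =
    wsum-mono-< _ _ (λ z → 𝟙-mono (map (λ z<y → <-trans z<y y<y′) (λ eq → trans eq same-part))
                                  (earlier-in-part? y z) (earlier-in-part? y′ z)) y
                (𝟙-no<𝟙-yes (not-earlier-than-itself y) (y<y′ , same-part)
                             (earlier-in-part? y y) (earlier-in-part? y′ y))

  rank-injective : ∀ {y y′} → part y ≡ part y′ → rank y ≡ rank y′ → y ≡ y′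
  rank-injective {y} {y′} same-part same-rank with <-cmp (toℕ y) (toℕ y′)
  ... | tri< y<y′ _ _ = ⊥-elim (<-irrefl same-rank (rank-mono-< same-part y<y′))
  ... | tri≈ _ y≡y′ _ = Finₚ.toℕ-injective y≡y′
  ... | tri> _ _ y′<y = ⊥-elim (<-irrefl (sym same-rank) (rank-mono-< (sym same-part) y′<y))

  -- Every vertex gets the colour given by its rank in its part; on the part of u, which has fewer than a
  -- vertices, the colours are punched around the colour of v.
  separating-colouring : ∀ a → (∀ p → ∣ P p ∣ ≤ a) → ∀ {u v} → part u ≢ part v → ∣ P (part u) ∣ < a →
                         Σ[ g ∈ (Fin n → Fin a) ] ((∀ x y → x ≢ y → g x ≡ g y → Adj G x y) × g u ≢ g v)
  separating-colouring (suc a) ∣P∣≤1+a {u} {v} pu≢pv (s≤s ∣Pu∣≤a) = g , g-sep , gu≢gv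
    where
    rank<1+a : ∀ y → rank y < suc a
    rank<1+a y = <-≤-trans (rank<∣P∣ y) (∣P∣≤1+a (part y))
    rank<a : ∀ y → part y ≡ part u → rank y < a
    rank<a y in-u = <-≤-trans (rank<∣P∣ y) (subst (λ p → ∣ P p ∣ ≤ a) (sym in-u) ∣Pu∣≤a)
    cᵥ : Fin (suc a)
    cᵥ = Fin.fromℕ< (rank<1+a v)
    colour : ∀ y → Dec (part y ≡ part u) → Fin (suc a)
    colour y (yes in-u) = Fin.punchIn cᵥ (Fin.fromℕ< (rank<a y in-u))
    colour y (no _)     = Fin.fromℕ< (rank<1+a y)
    g : Fin n → Fin (suc a)
    g y = colour y (part y Fin.≟ part u)
    same-colour⇒same-rank : ∀ {x y} (dx : Dec (part x ≡ part u)) (dy : Dec (part y ≡ part u)) →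
                            part x ≡ part y → colour x dx ≡ colour y dy → rank x ≡ rank y
    same-colour⇒same-rank {x} {y} (yes x-in-u) (yes y-in-u) _ same =
      trans (sym (Finₚ.toℕ-fromℕ< (rank<a x x-in-u)))
            (trans (cong toℕ (Finₚ.punchIn-injective cᵥ _ _ same)) (Finₚ.toℕ-fromℕ< (rank<a y y-in-u)))
    same-colour⇒same-rank {x} {y} (no _) (no _) _ same =
      trans (sym (Finₚ.toℕ-fromℕ< (rank<1+a x))) (trans (cong toℕ same) (Finₚ.toℕ-fromℕ< (rank<1+a y)))
    same-colour⇒same-rank (yes x-in-u)    (no y-not-in-u) px≡py _ = ⊥-elim (y-not-in-u (trans (sym px≡py) x-in-u))
    same-colour⇒same-rank (no x-not-in-u) (yes y-in-u)    px≡py _ = ⊥-elim (x-not-in-u (trans px≡py y-in-u))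
    g-sep : ∀ x y → x ≢ y → g x ≡ g y → Adj G x y
    g-sep x y x≢y same with part x Fin.≟ part y
    ... | no parts≢   = part≢⇒adj parts≢
    ... | yes same-part =
      ⊥-elim (x≢y (rank-injective same-part
                     (same-colour⇒same-rank (part x Fin.≟ part u) (part y Fin.≟ part u) same-part same)))
    gu≢gv : g u ≢ g v
    gu≢gv with part u Fin.≟ part u | part v Fin.≟ part u
    ... | no u-not-in-u | _          = ⊥-elim (u-not-in-u refl)
    ... | _             | yes v-in-u = ⊥-elim (pu≢pv (sym v-in-u))
    ... | yes _         | no _       = Finₚ.punchInᵢ≢i cᵥ _

  blowup-beats-colourCliques : ∀ {k m I′ w′} → 3 ≤ k → IsMaxKCliqueIndependent G k I′ →
    IsUniformOn m I′ w′ → k * ∣ I′ ∣ ≤ m →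
    ∀ {p₀ q₀} → p₀ ≢ q₀ → ∀ a → (∀ p → ∣ P p ∣ ≤ a) → (∀ p → p ≢ p₀ → ∣ P p ∣ < a) →
    Σ[ g ∈ (Fin n → Fin a) ] π k (colourCliques (g ∘ owner w′)) < π k (blowup G w′)
  blowup-beats-colourCliques {k} {I′ = I′} {w′} 3≤k I′-max w′-uniform k∣I′∣≤m p₀≢q₀ a ∣P∣≤a ∣P∣<a
    with u , v , u∈I′ , v∈I′ , pu≢pv , pu≢p₀ ← maxKCliqueIndependent-meets-two-parts 3≤k I′-max p₀≢q₀
    with g , g-sep , gu≢gv ← separating-colouring a ∣P∣≤a pu≢pv (∣P∣<a (part u) pu≢p₀)
    = g , π-colourCliques<π-blowup G w′ g g-sep (part≢⇒adj pu≢pv) gu≢gv k 2≤k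
                                   (k≤w′ v v∈I′) (≤-trans (≤-trans (s≤s z≤n) 2≤k) (k≤w′ u u∈I′))
    where
    2≤k : 2 ≤ k
    2≤k = ≤-trans (n≤1+n 2) 3≤k
    k≤w′ : ∀ x → x ∈ I′ → k ≤ w′ x
    k≤w′ = uniform⇒k≤weight w′-uniform k∣I′∣≤m

theorem10 : ∀ {n : ℕ} (G : Graph n) (s : ℕ) (part : Fin n → Fin (suc (suc s)))
            → IsCompleteMultipartiteBy G part
            → ∣ partSet part (suc zero) ∣ < ∣ partSet part zero ∣
            → (∀ (i j : Fin (suc (suc s))) → 1 ≤ toℕ i → toℕ i ≤ toℕ j
                 → ∣ partSet part j ∣ ≤ ∣ partSet part i ∣)
            → (k m : ℕ) → 3 ≤ k
            → (I I' : Subset n) → IsMaxIndependent G I → IsMaxKCliqueIndependent G k I'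
            → k * ∣ I' ∣ ≤ m
            → (w w' : Fin n → ℕ) → wsum w ≡ m → wsum w' ≡ m
            → IsUniformOn m I w → IsUniformOn m I' w'
            → π k (blowup G w) < π k (blowup G w')
theorem10 G s part multipartite ∣P₁∣<∣P₀∣ sorted k@(suc k₁) m 3≤k I I′ (I-independent , I-maximum) I′-max
          k∣I′∣≤m w w′ ∑w≡m ∑w′≡m w-uniform w′-uniform = begin-strict
  π k (blowup G w)                              ≡⟨ π-blowup-independent G I-independent w (proj₁ w-balanced) k₁ ⟩
  wsum (λ x → w x C k)                          ≤⟨ balanced-minimises-wsum-C _ k₁ w-balanced _ refl ∑colours≡∑w ⟩
  wsum (λ j → ∣ partSet (g ∘ owner w′) j ∣ C k) ≡⟨ π-colourCliques (g ∘ owner w′) k₁ ⟨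
  π k (colourCliques (g ∘ owner w′))            <⟨ proj₂ beaten ⟩
  π k (blowup G w′)                             ∎
  where
  open CompleteMultipartite G part multipartite
  open ≤-Reasoning
  w-balanced = uniform⇒balanced w-uniform
  ∣P∣<∣I∣ : ∀ p → p ≢ zero → ∣ P p ∣ < ∣ I ∣
  ∣P∣<∣I∣ zero    0≢0 = ⊥-elim (0≢0 refl)
  ∣P∣<∣I∣ (suc p) _   = begin-strict
    ∣ P (suc p) ∣    ≤⟨ sorted (suc zero) (suc p) (s≤s z≤n) (s≤s z≤n) ⟩
    ∣ P (suc zero) ∣ <⟨ ∣P₁∣<∣P₀∣ ⟩
    ∣ P zero ∣       ≤⟨ I-maximum (P zero) (P-independent zero) ⟩
    ∣ I ∣            ∎
  beaten = blowup-beats-colourCliques 3≤k I′-max w′-uniform k∣I′∣≤m {zero} {suc zero} (λ ()) ∣ I ∣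
                                      (λ p → I-maximum (P p) (P-independent p)) ∣P∣<∣I∣
  g = proj₁ beaten
  ∑colours≡∑w : wsum (λ j → ∣ partSet (g ∘ owner w′) j ∣) ≡ wsum w
  ∑colours≡∑w = trans (wsum-∣partSet∣ (g ∘ owner w′)) (trans ∑w′≡m (sym ∑w≡m))
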